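{- Let $T$ be a tree with $t$ almost-leaves, where $t \geq 2$. Then $\mathrm{thin}(T) \leq t-1$.
   Context: A graph $G$ is $k$-thin if there exist a strict total order $\prec$ on $V(G)$ and a partition of $V(G)$ into $k$ classes such that for all $u \prec v \prec w$ with $u,v$ in the same class and $(u,w)\in E(G)$, also $(v,w)\in E(G)$; the thinness $\mathrm{thin}(G)$ is the minimum such $k$. A leaf of a tree is a vertex of degree one; an almost-leaf is a vertex which is not a leaf and has at most one neighbor that is not a leaf. -}

module Defs where

open import Level using (0ℓ)
open import Data.Nat using (ℕ; _≤_; _∸_)
open import Data.Fin using (Fin)
open import Data.List using (List; []; _∷_; _++_; length; filter; allFin)
open import Data.List.Relation.Unary.Unique.Propositional using (Unique)
open import Data.Product using (Σ; ∃; ∃-syntax; _×_; _,_)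
open import Data.Sum using (_⊎_)
open import Data.Empty using (⊥)
open import Relation.Nullary using (¬_; Dec; yes; no)
open import Relation.Binary using (Rel; Decidable; Symmetric; IsStrictTotalOrder)
open import Relation.Binary.PropositionalEquality using (_≡_)

record Graph : Set₁ where
  field
    n     : ℕ
    E     : Rel (Fin n) 0ℓ
    E?    : Decidable E
    Esym  : Symmetric E
    Eirr  : ∀ v → ¬ E v v

module _ (G : Graph) where
  open Graph G

  Chain : List (Fin n) → Set
  Chain []            = Data.Unit.⊤ where import Data.Unit
  Chain (x ∷ [])      = Data.Unit.⊤ where import Data.Unit
  Chain (x ∷ y ∷ xs)  = E x y × Chain (y ∷ xs)

  Connected : Set
  Connected = ∀ u v → u ≡ v ⊎ ∃[ xs ] Chain (u ∷ xs ++ v ∷ [])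

  IsCycle : Fin n → List (Fin n) → Set
  IsCycle x ys = 2 ≤ length ys × Unique (x ∷ ys) × Chain (x ∷ ys ++ x ∷ [])

  Acyclic : Set
  Acyclic = ∀ x ys → ¬ IsCycle x ys

  IsTree : Set
  IsTree = Connected × Acyclic

  degree : Fin n → ℕ
  degree v = length (filter (E? v) (allFin n))

  IsLeaf : Fin n → Set
  IsLeaf v = degree v ≡ 1

  isLeaf? : (v : Fin n) → Dec (IsLeaf v)
  isLeaf? v = degree v Data.Nat.≟ 1 where import Data.Nat

  nonLeafNeighbours : Fin n → ℕ
  nonLeafNeighbours v =
    length (filter (λ w → Relation.Nullary.Decidable._×-dec_ (E? v w) (Relation.Nullary.¬? (isLeaf? w))) (allFin n))
    where import Relation.Nullary.Decidable

  IsAlmostLeaf : Fin n → Set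
  IsAlmostLeaf v = ¬ IsLeaf v × nonLeafNeighbours v ≤ 1

  isAlmostLeaf? : (v : Fin n) → Dec (IsAlmostLeaf v)
  isAlmostLeaf? v = Relation.Nullary.Decidable._×-dec_ (Relation.Nullary.¬? (isLeaf? v)) (nonLeafNeighbours v Data.Nat.≤? 1)
    where import Relation.Nullary.Decidable
          import Data.Nat

  numAlmostLeaves : ℕ
  numAlmostLeaves = length (filter isAlmostLeaf? (allFin n))

  IsKThin : ℕ → Set₁
  IsKThin k = Σ (Rel (Fin n) 0ℓ) λ _≺_ → IsStrictTotalOrder _≡_ _≺_ ×
              Σ (Fin n → Fin k) λ cls →
                ∀ u v w → u ≺ v → v ≺ w → cls u ≡ cls v → E u w → E v w

  ThinAtMost : ℕ → Set₁
  ThinAtMost k = ∃[ j ] (j ≤ k × IsKThin j)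

-- Root T at an almost-leaf r and list the vertices so that every subtree comes
-- right before its root, with the subtrees of non-leaf children before the leaf
-- children (reversed lexicographic order of the labelled root paths).  A non-leaf
-- vertex is classed by an almost-leaf other than r below it (the deepest non-leaf
-- vertex below it is one), a leaf by the class of its parent.  If u ≺ v ≺ w and uw
-- is an edge, then w is the parent of u, and v is either another child of w or lies
-- strictly below a later non-leaf sibling c of u; in that case u is not a leaf
-- either, and the classes of u and v lie in the disjoint subtrees of u and c.

module Submission where

open import Level using (0ℓ)
open import Defs
open import Algebra.Definitions.RawMagma using (_∣ˡ_)
open import Data.Empty using (⊥-elim)
open import Data.Fin using (Fin; toℕ; _≟_)
open import Data.Fin.Properties using (any?; toℕ-injective; toℕ<n)
open import Data.List as List using (List; []; _∷_; _++_; [_]; length; filter; allFin)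
open import Data.List.Extrema.Nat using (argmax; argmax-all; f[xs]≤f[argmax])
open import Data.List.Membership.Propositional using (_∈_; _∉_)
open import Data.List.Membership.Propositional.Properties using (∈-++⁺ʳ; ∈-filter⁺; ∈-filter⁻; ∈-allFin)
import Data.List.Membership.DecPropositional as DecMembership
open import Data.List.Properties
  using (∷-injective; ∷ʳ-injective; ++-cancelˡ; ++-assoc; ++-identityʳ; ++-conicalˡ; ++-conicalʳ; filter-notAll)
open import Data.List.Relation.Binary.Lex.Strict as Lex using (Lex-<; base; halt; this; next)
open import Data.List.Relation.Binary.Pointwise using (Pointwise-≡⇒≡)
open import Data.List.Relation.Binary.Prefix.Heterogeneous.Properties using (prefix?)
open import Data.List.Relation.Binary.Prefix.Propositional.Properties using (Prefix-as-∣ˡ; ∣ˡ-as-Prefix)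
open import Data.List.Relation.Unary.All using ([]; _∷_; lookup)
open import Data.List.Relation.Unary.All.Properties using (¬Any⇒All¬; all-filter)
open import Data.List.Relation.Unary.AllPairs using ([]; _∷_)
open import Data.List.Relation.Unary.Any as Any using (here; there; index)
open import Data.List.Relation.Unary.Any.Properties using (lookup-index)
open import Data.List.Relation.Unary.Unique.Propositional using (Unique)
open import Data.List.Relation.Unary.Unique.Propositional.Properties
  using (allFin⁺) renaming (filter⁺ to Unique-filter⁺)
open import Data.Nat using (ℕ; zero; suc; _+_; _∸_; _≤_; _<_; _>_; s≤s; z≤n) renaming (_≟_ to _≟ℕ_)
open import Data.Nat.Induction using (<-rec; <-wellFounded)
open import Data.Nat.Properties as ℕ
  using (anyUpTo?; ≤-refl; ≤-<-trans; <-≤-trans; <-irrefl; <-asym; ≮⇒≥; <⇒≱; <⇒≤pred; m≤m+n; +-cancelˡ-≡)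
open import Data.Product using (Σ; ∃-syntax; ∃₂; _×_; _,_; proj₁; proj₂)
open import Data.Sum using (_⊎_; inj₁; inj₂)
open import Data.Unit using (tt)
open import Function using (_on_; _∘′_)
open import Induction.WellFounded using (module All)
open import Relation.Binary
  using (Rel; Decidable; Asymmetric; IsStrictTotalOrder; Trichotomous; DecidableEquality; tri<; tri≈; tri>)
open import Relation.Binary.Construct.Closure.ReflexiveTransitive using (Star; ε; _◅_; _◅◅_; reverse)
import Relation.Binary.Construct.Flip.EqAndOrd as Flip
import Relation.Binary.Construct.On as On
open import Relation.Binary.PropositionalEquality hiding ([_])
open import Relation.Nullary using (¬_; Dec; yes; no)
open import Relation.Nullary.Decidable using (map′; _×-dec_; _⊎-dec_; ¬?; toSum)
open import Relation.Unary as U using (Pred)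

least-witness : {P : ℕ → Set} → U.Decidable P →
                ∀ m → P m → ∃[ k ] P k × (∀ j → j < k → ¬ P j)
least-witness {P} P? = <-rec (λ m → P m → ∃[ k ] P k × (∀ j → j < k → ¬ P j)) search
  where
  search : ∀ m → (∀ {j} → j < m → P j → ∃[ k ] P k × (∀ i → i < k → ¬ P i)) →
           P m → ∃[ k ] P k × (∀ j → j < k → ¬ P j)
  search m smaller pm with anyUpTo? P? m
  ... | yes (j , j<m , pj) = smaller j<m pj
  ... | no ∄j             = m , pm , λ j j<m pj → ∄j (j , j<m , pj)

prefix-of-∷ʳ : ∀ {A : Set} (xs : List A) y ys zs z →
               xs ++ y ∷ ys ≡ zs ++ [ z ] → ∃[ ms ] zs ≡ xs ++ ms
prefix-of-∷ʳ []       y ys zs       z eq = zs , refl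
prefix-of-∷ʳ (x ∷ []) y ys []       z ()
prefix-of-∷ʳ (x ∷ _ ∷ _) y ys []    z ()
prefix-of-∷ʳ (x ∷ xs) y ys (_ ∷ zs) z eq with refl , eq′ ← ∷-injective eq
  with ms , refl ← prefix-of-∷ʳ xs y ys zs z eq′ = ms , refl

Unique-++⁻ʳ : ∀ {A : Set} (xs : List A) {ys} → Unique (xs ++ ys) → Unique ys
Unique-++⁻ʳ []       u       = u
Unique-++⁻ʳ (_ ∷ xs) (_ ∷ u) = Unique-++⁻ʳ xs u

distinct-members⇒2≤length : ∀ {A : Set} {x y : A} {xs} → x ∈ xs → y ∈ xs → x ≢ y → 2 ≤ length xs
distinct-members⇒2≤length {xs = _ ∷ _ ∷ _} _           _           _   = s≤s (s≤s z≤n)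
distinct-members⇒2≤length {xs = _ ∷ []}    (here refl) (here refl) x≢y = ⊥-elim (x≢y refl)

Unique⇒distinct-members : ∀ {A : Set} {xs : List A} → Unique xs → 2 ≤ length xs →
                          ∃₂ λ x y → x ∈ xs × y ∈ xs × x ≢ y
Unique⇒distinct-members {xs = x ∷ y ∷ _} ((x≢y ∷ _) ∷ _) _ = x , y , here refl , there (here refl) , x≢y
Unique⇒distinct-members {xs = _ ∷ []} _ (s≤s ())

_⊑_ : ∀ {A : Set} → Rel (List A) 0ℓ
xs ⊑ ys = ∃[ zs ] ys ≡ xs ++ zs

module _ {A : Set} (_≟_ : DecidableEquality A) where

  _⊑?_ : Decidable (_⊑_ {A})
  xs ⊑? ys = map′ (λ p → _∣ˡ_.quotient (Prefix-as-∣ˡ p) , sym (_∣ˡ_.equality (Prefix-as-∣ˡ p)))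
                  (λ (zs , eq) → ∣ˡ-as-Prefix record { quotient = zs ; equality = sym eq })
                  (prefix? _≟_ xs ys)

module _ {A : Set} {_<_ : Rel A 0ℓ} (<-asym : Asymmetric _<_) where

  Lex-<-¬extension<prefix : ∀ xs y ys → ¬ Lex-< _≡_ _<_ (xs ++ y ∷ ys) xs
  Lex-<-¬extension<prefix []       y ys ()
  Lex-<-¬extension<prefix (x ∷ xs) y ys (this x<x)   = <-asym x<x x<x
  Lex-<-¬extension<prefix (x ∷ xs) y ys (next _ lex) = Lex-<-¬extension<prefix xs y ys lex

  Lex-<-between-∷ʳ : ∀ xs a vs → Lex-< _≡_ _<_ xs vs → Lex-< _≡_ _<_ vs (xs ++ [ a ]) →
                     ∃₂ λ b ws → vs ≡ xs ++ b ∷ ws × b < a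
  Lex-<-between-∷ʳ []       a []       (base ()) _
  Lex-<-between-∷ʳ []       a (b ∷ ws) halt      (this b<a)    = b , ws , refl , b<a
  Lex-<-between-∷ʳ []       a (b ∷ ws) halt      (next _ (base ()))
  Lex-<-between-∷ʳ (x ∷ xs) a []       ()        _
  Lex-<-between-∷ʳ (x ∷ xs) a (v ∷ vs) (this x<v) (this v<x)     = ⊥-elim (<-asym x<v v<x)
  Lex-<-between-∷ʳ (x ∷ xs) a (v ∷ vs) (this x<v) (next refl _)  = ⊥-elim (<-asym x<v x<v)
  Lex-<-between-∷ʳ (x ∷ xs) a (v ∷ vs) (next refl _) (this v<v)  = ⊥-elim (<-asym v<v v<v)
  Lex-<-between-∷ʳ (x ∷ xs) a (v ∷ vs) (next refl l) (next _ l′)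
    with b , ws , refl , b<a ← Lex-<-between-∷ʳ xs a vs l l′ = b , ws , refl , b<a

module _ {A B : Set} {_≈_ _<_ : Rel B 0ℓ} (sto : IsStrictTotalOrder _≈_ _<_)
         (f : A → B) (f-injective : ∀ {x y} → f x ≈ f y → x ≡ y) where
  private module O = IsStrictTotalOrder sto

  isStrictTotalOrder-on-injective : IsStrictTotalOrder _≡_ (_<_ on f)
  isStrictTotalOrder-on-injective = record
    { isStrictPartialOrder = record
      { isEquivalence = isEquivalence
      ; irrefl        = λ { refl → O.irrefl O.Eq.refl }
      ; trans         = O.trans
      ; <-resp-≈      = (λ { refl lt → lt }) , (λ { refl lt → lt })
      }
    ; compare = compare-on
    }
    where
    ≡⇒≈ : ∀ {x y} → x ≡ y → f x ≈ f y
    ≡⇒≈ refl = O.Eq.refl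
    compare-on : Trichotomous _≡_ (_<_ on f)
    compare-on x y with O.compare (f x) (f y)
    ... | tri< a ¬b ¬c = tri< a (¬b ∘′ ≡⇒≈) ¬c
    ... | tri≈ ¬a b ¬c = tri≈ ¬a (f-injective b) ¬c
    ... | tri> ¬a ¬b c = tri> ¬a (¬b ∘′ ≡⇒≈) c

module LoopErasure {A : Set} (_≟_ : DecidableEquality A) {R : Rel A 0ℓ} where
  open DecMembership _≟_ using (_∈?_)

  vertices : ∀ {a c} → Star R a c → List A
  vertices ε                = []
  vertices (_◅_ {a} _ walk) = a ∷ vertices walk

  suffix-from : ∀ {b c a} (walk : Star R b c) → a ∈ vertices walk →
                Σ (Star R a c) λ s → ∃[ pre ] vertices walk ≡ pre ++ vertices s
  suffix-from (e ◅ walk)         (here refl) = e ◅ walk , [] , refl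
  suffix-from (_◅_ {b} _ walk) (there a∈)
    with s , pre , eq ← suffix-from walk a∈ = s , b ∷ pre , cong (b ∷_) eq

  loop-erase : ∀ {a c} → Star R a c → Σ (Star R a c) λ q → Unique (vertices q) × c ∉ vertices q
  loop-erase ε = ε , [] , λ ()
  loop-erase {a} {c} (e ◅ walk) with loop-erase walk | a ≟ c
  ... | _ , _ , _ | yes refl = ε , [] , λ ()
  ... | q , unique , c∉ | no a≢c with a ∈? vertices q
  ...   | no a∉ =
    e ◅ q , ¬Any⇒All¬ _ a∉ ∷ unique , λ { (here c≡a) → a≢c (sym c≡a) ; (there c∈) → c∉ c∈ }
  ...   | yes a∈ with s , pre , eq ← suffix-from q a∈ =
    s , Unique-++⁻ʳ pre (subst Unique eq unique) , λ c∈ → c∉ (subst (c ∈_) (sym eq) (∈-++⁺ʳ pre c∈))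

module _ (G : Graph) where
  open Graph G

  two-neighbours⇒¬leaf : ∀ {v a b} → E v a → E v b → a ≢ b → ¬ IsLeaf G v
  two-neighbours⇒¬leaf {v} {a} {b} va vb a≢b leaf =
    <-irrefl (sym leaf)
      (distinct-members⇒2≤length (∈-filter⁺ (E? v) (∈-allFin a) va) (∈-filter⁺ (E? v) (∈-allFin b) vb) a≢b)

  nonLeafNeighbours≤1 : ∀ {y} c → (∀ {z} → E y z → ¬ IsLeaf G z → z ≡ c) → nonLeafNeighbours G y ≤ 1
  nonLeafNeighbours≤1 {y} c only-c = ≮⇒≥ λ 2≤count →
    let nonLeafNeighbour? = λ w → E? y w ×-dec ¬? (isLeaf? G w)
        (a , b , a∈ , b∈ , a≢b) = Unique⇒distinct-members (Unique-filter⁺ nonLeafNeighbour? (allFin⁺ n)) 2≤count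
        (_ , ya , ¬leaf-a) = ∈-filter⁻ nonLeafNeighbour? {xs = allFin n} a∈
        (_ , yb , ¬leaf-b) = ∈-filter⁻ nonLeafNeighbour? {xs = allFin n} b∈
    in a≢b (trans (only-c ya ¬leaf-a) (sym (only-c yb ¬leaf-b)))

module RootedTree (G : Graph) (connected : Connected G) (acyclic : Acyclic G) (r : Fin (Graph.n G)) where
  open Graph G

  Reaches : ℕ → Fin n → Set
  Reaches zero    v = v ≡ r
  Reaches (suc k) v = Reaches k v ⊎ ∃[ z ] E v z × Reaches k z

  reaches? : ∀ k → U.Decidable (Reaches k)
  reaches? zero    v = v ≟ r
  reaches? (suc k) v = reaches? k v ⊎-dec any? (λ z → E? v z ×-dec reaches? k z)

  reaches-along : ∀ {k a} zs v → Reaches k a → Chain G (a ∷ zs ++ [ v ]) → ∃[ m ] Reaches m v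
  reaches-along {k} {a} []       v ra (av , _)  = suc k , inj₂ (a , Esym av , ra)
  reaches-along {k} {a} (z ∷ zs) v ra (az , ch) = reaches-along zs v (inj₂ (a , Esym az , ra)) ch

  reaches : ∀ v → ∃[ k ] Reaches k v
  reaches v with connected r v
  ... | inj₁ refl         = 0 , refl
  ... | inj₂ (zs , chain) = reaches-along zs v refl chain

  depth-witness : ∀ v → ∃[ k ] Reaches k v × (∀ j → j < k → ¬ Reaches j v)
  depth-witness v = least-witness (λ k → reaches? k v) (proj₁ (reaches v)) (proj₂ (reaches v))

  opaque
    depth : Fin n → ℕ
    depth v = proj₁ (depth-witness v)

    depth-≤ : ∀ {k v} → Reaches k v → depth v ≤ k
    depth-≤ {k} {v} rk = ≮⇒≥ λ k<depth → proj₂ (proj₂ (depth-witness v)) k k<depth rk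

    closer-neighbour : ∀ {v} → v ≢ r → ∃[ z ] E v z × depth z < depth v
    closer-neighbour {v} v≢r with depth-witness v
    ... | zero  , v≡r , _                = ⊥-elim (v≢r v≡r)
    ... | suc k , inj₁ rk , minimal       = ⊥-elim (minimal k ≤-refl rk)
    ... | suc k , inj₂ (z , vz , rz) , _ = z , vz , s≤s (depth-≤ rz)

  opaque
    parent-by : ∀ v → Dec (v ≡ r) → Fin n
    parent-by v (yes _)   = r
    parent-by v (no v≢r) = proj₁ (closer-neighbour v≢r)

    parent : Fin n → Fin n
    parent v = parent-by v (v ≟ r)

    parent-spec : ∀ {v} → v ≢ r → E v (parent v) × depth (parent v) < depth v
    parent-spec {v} v≢r = spec (v ≟ r)
      where
      spec : (d : Dec (v ≡ r)) → E v (parent-by v d) × depth (parent-by v d) < depth v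
      spec (yes v≡r) = ⊥-elim (v≢r v≡r)
      spec (no v≢r′) = proj₂ (closer-neighbour v≢r′)

  parent-adjacent : ∀ {v} → v ≢ r → E v (parent v)
  parent-adjacent v≢r = proj₁ (parent-spec v≢r)

  depth-parent : ∀ {v} → v ≢ r → depth (parent v) < depth v
  depth-parent v≢r = proj₂ (parent-spec v≢r)

  parent-induction : (P : Pred (Fin n) 0ℓ) → P r → (∀ {v} → v ≢ r → P (parent v) → P v) → ∀ v → P v
  parent-induction P P-root P-step = All.wfRec (On.wellFounded depth <-wellFounded) 0ℓ P induct
    where
    induct : ∀ v → (∀ {u} → depth u < depth v → P u) → P v
    induct v ih with v ≟ r
    ... | yes refl = P-root
    ... | no v≢r  = P-step v≢r (ih (depth-parent v≢r))

  parent-not-leaf : ∀ {v} → v ≢ r → parent v ≢ r → ¬ IsLeaf G (parent v)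
  parent-not-leaf {v} v≢r pv≢r =
    two-neighbours⇒¬leaf G (Esym (parent-adjacent v≢r)) (parent-adjacent pv≢r) v≢ppv
    where
    v≢ppv : v ≢ parent (parent v)
    v≢ppv v≡ppv =
      <-asym (depth-parent v≢r) (subst (λ x → depth (parent v) > depth x) (sym v≡ppv) (depth-parent pv≢r))

  ParentEdge : Rel (Fin n) 0ℓ
  ParentEdge x y = (x ≢ r × parent x ≡ y) ⊎ (y ≢ r × parent y ≡ x)

  parentEdge? : Decidable ParentEdge
  parentEdge? x y = (¬? (x ≟ r) ×-dec (parent x ≟ y)) ⊎-dec (¬? (y ≟ r) ×-dec (parent y ≟ x))

  ParentEdge-sym : ∀ {x y} → ParentEdge x y → ParentEdge y x
  ParentEdge-sym (inj₁ up)   = inj₂ up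
  ParentEdge-sym (inj₂ down) = inj₁ down

  ParentEdge⇒E : ∀ {x y} → ParentEdge x y → E x y
  ParentEdge⇒E (inj₁ (x≢r , refl)) = parent-adjacent x≢r
  ParentEdge⇒E (inj₂ (y≢r , refl)) = Esym (parent-adjacent y≢r)

  path-to-root : ∀ v → Star ParentEdge v r
  path-to-root = parent-induction (λ v → Star ParentEdge v r) ε (λ v≢r path → inj₁ (v≢r , refl) ◅ path)

  open LoopErasure _≟_ {ParentEdge}

  chain-of-walk : ∀ {a c} (walk : Star ParentEdge a c) → Chain G (vertices walk ++ [ c ])
  chain-of-walk ε                   = tt
  chain-of-walk (e ◅ ε)             = ParentEdge⇒E e , tt
  chain-of-walk (e ◅ walk@(_ ◅ _)) = ParentEdge⇒E e , chain-of-walk walk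

  -- Joining u and w through the root and erasing loops gives a path; if uw were
  -- not a parent edge, that path would close up with uw to a cycle.
  edge⇒ParentEdge : ∀ {u w} → E u w → ParentEdge u w
  edge⇒ParentEdge {u} {w} uw with parentEdge? u w
  ... | yes parent-edge = parent-edge
  ... | no ¬parent-edge with loop-erase (path-to-root u ◅◅ reverse ParentEdge-sym (path-to-root w))
  ...   | ε , _ , _ = ⊥-elim (Eirr u uw)
  ...   | e ◅ ε , _ , _ = ⊥-elim (¬parent-edge e)
  ...   | path@(_ ◅ _ ◅ _) , unique , w∉ =
    ⊥-elim (acyclic w (vertices path) (s≤s (s≤s z≤n) , ¬Any⇒All¬ _ w∉ ∷ unique , Esym uw , chain-of-walk path))

  -- Non-leaves get the larger labels, so that in the order _≺_ below the subtree of a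
  -- non-leaf child comes before the leaf children of the same parent.
  label : Fin n → ℕ
  label x with isLeaf? G x
  ... | yes _ = toℕ x
  ... | no _  = n + toℕ x

  label-leaf : ∀ {x} → IsLeaf G x → label x < n
  label-leaf {x} leaf with isLeaf? G x
  ... | yes _     = toℕ<n x
  ... | no ¬leaf = ⊥-elim (¬leaf leaf)

  label-non-leaf : ∀ {x} → ¬ IsLeaf G x → n ≤ label x
  label-non-leaf {x} ¬leaf with isLeaf? G x
  ... | yes leaf = ⊥-elim (¬leaf leaf)
  ... | no _     = m≤m+n n (toℕ x)

  label-injective : ∀ {x y} → label x ≡ label y → x ≡ y
  label-injective {x} {y} eq with isLeaf? G x | isLeaf? G y
  ... | yes _ | yes _ = toℕ-injective eq
  ... | yes _ | no _  = ⊥-elim (<⇒≱ (toℕ<n x) (subst (n ≤_) (sym eq) (m≤m+n n (toℕ y))))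
  ... | no _  | yes _ = ⊥-elim (<⇒≱ (toℕ<n y) (subst (n ≤_) eq (m≤m+n n (toℕ x))))
  ... | no _  | no _  = toℕ-injective (+-cancelˡ-≡ n _ _ eq)

  -- The labels along the path from the root; k is fuel, sufficient once depth v < k.
  key-within : ℕ → Fin n → List ℕ
  key-within-by : ℕ → ∀ v → Dec (v ≡ r) → List ℕ
  key-within zero    v = []
  key-within (suc k) v = key-within-by k v (v ≟ r)
  key-within-by k v (yes _) = []
  key-within-by k v (no _)  = key-within k (parent v) ++ [ label v ]

  key-within-root : ∀ k → key-within (suc k) r ≡ []
  key-within-root k with r ≟ r
  ... | yes _   = refl
  ... | no r≢r = ⊥-elim (r≢r refl)

  key-within-parent : ∀ {k v} → v ≢ r → key-within (suc k) v ≡ key-within k (parent v) ++ [ label v ]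
  key-within-parent {k} {v} v≢r = unfold (v ≟ r)
    where
    unfold : (d : Dec (v ≡ r)) → key-within-by k v d ≡ key-within k (parent v) ++ [ label v ]
    unfold (yes v≡r) = ⊥-elim (v≢r v≡r)
    unfold (no _)    = refl

  key-within-stable : ∀ {k k′} v → depth v < k → depth v < k′ → key-within k v ≡ key-within k′ v
  key-within-stable {suc k} {suc k′} v (s≤s v<k) (s≤s v<k′) with toSum (v ≟ r)
  ... | inj₁ refl = trans (key-within-root k) (sym (key-within-root k′))
  ... | inj₂ v≢r  = begin
    key-within (suc k) v                      ≡⟨ key-within-parent v≢r ⟩
    key-within k (parent v) ++ [ label v ]    ≡⟨ cong (_++ [ label v ]) (key-within-stable (parent v) p<k p<k′) ⟩
    key-within k′ (parent v) ++ [ label v ]   ≡⟨ key-within-parent v≢r ⟨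
    key-within (suc k′) v                     ∎
    where
    open ≡-Reasoning
    p<k : depth (parent v) < k
    p<k = <-≤-trans (depth-parent v≢r) v<k
    p<k′ : depth (parent v) < k′
    p<k′ = <-≤-trans (depth-parent v≢r) v<k′

  key : Fin n → List ℕ
  key v = key-within (suc (depth v)) v

  key-root : key r ≡ []
  key-root = key-within-root (depth r)

  key-parent : ∀ {v} → v ≢ r → key v ≡ key (parent v) ++ [ label v ]
  key-parent {v} v≢r = trans (key-within-parent v≢r)
    (cong (_++ [ label v ]) (key-within-stable (parent v) (depth-parent v≢r) ≤-refl))

  nonempty-key⇒≢root : ∀ {v} xs y ys → key v ≡ xs ++ y ∷ ys → v ≢ r
  nonempty-key⇒≢root xs y ys eq refl with () ← ++-conicalʳ xs (y ∷ ys) (trans (sym eq) key-root)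

  key-injective : ∀ {u v} → key u ≡ key v → u ≡ v
  key-injective {u} {v} eq with toSum (u ≟ r) | toSum (v ≟ r)
  ... | inj₁ refl | inj₁ refl = refl
  ... | inj₁ refl | inj₂ v≢r  = ⊥-elim (nonempty-key⇒≢root _ _ [] (trans eq (key-parent v≢r)) refl)
  ... | inj₂ u≢r  | inj₁ refl = ⊥-elim (nonempty-key⇒≢root _ _ [] (trans (sym eq) (key-parent u≢r)) refl)
  ... | inj₂ u≢r  | inj₂ v≢r  =
    label-injective (proj₂ (∷ʳ-injective _ _ (trans (sym (key-parent u≢r)) (trans eq (key-parent v≢r)))))

  key-∷ʳ⇒parent : ∀ {v w} b → key v ≡ key w ++ [ b ] → v ≢ r × parent v ≡ w × label v ≡ b
  key-∷ʳ⇒parent {v} {w} b eq =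
    let (parent-keys , labels) = ∷ʳ-injective _ _ (trans (sym (key-parent v≢r)) eq)
    in v≢r , key-injective parent-keys , labels
    where
    v≢r : v ≢ r
    v≢r = nonempty-key⇒≢root (key w) b [] eq

  _≼_ : Rel (Fin n) 0ℓ
  x ≼ y = key x ⊑ key y

  _≼?_ : Decidable _≼_
  x ≼? y = _⊑?_ _≟ℕ_ (key x) (key y)

  ≼-refl : ∀ {x} → x ≼ x
  ≼-refl {x} = [] , sym (++-identityʳ (key x))

  ≼-root : ∀ {x} → x ≼ r → x ≡ r
  ≼-root {x} (zs , eq) =
    key-injective (trans (++-conicalˡ (key x) zs (trans (sym eq) key-root)) (sym key-root))

  ≼-child : ∀ {x v} → x ≼ parent v → v ≢ r → x ≼ v
  ≼-child {x} {v} (zs , eq) v≢r = zs ++ [ label v ] , (begin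
    key v                                 ≡⟨ key-parent v≢r ⟩
    key (parent v) ++ [ label v ]         ≡⟨ cong (_++ [ label v ]) eq ⟩
    (key x ++ zs) ++ [ label v ]          ≡⟨ ++-assoc (key x) zs [ label v ] ⟩
    key x ++ zs ++ [ label v ]            ∎)
    where open ≡-Reasoning

  _⊏_ : Rel (Fin n) 0ℓ
  x ⊏ y = ∃₂ λ z zs → key y ≡ key x ++ z ∷ zs

  ⊏⇒≼ : ∀ {x y} → x ⊏ y → x ≼ y
  ⊏⇒≼ (z , zs , eq) = z ∷ zs , eq

  ≼-parent : ∀ {x v} → x ⊏ v → x ≼ parent v
  ≼-parent {x} {v} (z , zs , eq) = prefix-of-∷ʳ (key x) z zs (key (parent v)) (label v)
    (trans (sym eq) (key-parent (nonempty-key⇒≢root (key x) z zs eq)))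

  key-prefix-closed : ∀ v xs ys → key v ≡ xs ++ ys → ∃[ x ] key x ≡ xs
  key-prefix-closed = parent-induction (λ v → ∀ xs ys → key v ≡ xs ++ ys → ∃[ x ] key x ≡ xs) at-root step
    where
    at-root : ∀ xs ys → key r ≡ xs ++ ys → ∃[ x ] key x ≡ xs
    at-root xs ys eq = r , trans key-root (sym (++-conicalˡ xs ys (trans (sym eq) key-root)))
    step : ∀ {v} → v ≢ r → (∀ xs ys → key (parent v) ≡ xs ++ ys → ∃[ x ] key x ≡ xs) →
           ∀ xs ys → key v ≡ xs ++ ys → ∃[ x ] key x ≡ xs
    step {v} v≢r ih xs []       eq = v , trans eq (++-identityʳ xs)
    step {v} v≢r ih xs (y ∷ ys) eq =
      let (ms , eq′) = prefix-of-∷ʳ xs y ys (key (parent v)) (label v) (trans (sym eq) (key-parent v≢r))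
      in ih xs ms eq′

  child-towards : ∀ {v w} b ys → key v ≡ key w ++ b ∷ ys →
                  ∃[ c ] c ≢ r × parent c ≡ w × label c ≡ b × key v ≡ key c ++ ys
  child-towards {v} {w} b ys eq =
    let (c , kc) = key-prefix-closed v (key w ++ [ b ]) ys (trans eq (sym (++-assoc (key w) [ b ] ys)))
        (c≢r , parent-c≡w , label-c≡b) = key-∷ʳ⇒parent {c} {w} b kc
    in c , c≢r , parent-c≡w , label-c≡b ,
       trans eq (trans (sym (++-assoc (key w) [ b ] ys)) (cong (_++ ys) (sym kc)))

  proper-ancestor-not-leaf : ∀ {c v} → c ⊏ v → c ≢ r → ¬ IsLeaf G c
  proper-ancestor-not-leaf {c} {v} (l , ls , eq) c≢r
    with d , d≢r , refl , _ , _ ← child-towards {v} {c} l ls eq = parent-not-leaf d≢r c≢r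

  ≼-trans : ∀ {x y z} → x ≼ y → y ≼ z → x ≼ z
  ≼-trans {x} {y} {z} (xs , y≡x++xs) (ys , z≡y++ys) =
    xs ++ ys , trans z≡y++ys (trans (cong (_++ ys) y≡x++xs) (++-assoc (key x) xs ys))

  siblings-disjoint : ∀ {u c y} → u ≢ r → c ≢ r → parent u ≡ parent c → u ≼ y → c ≼ y → u ≡ c
  siblings-disjoint {u} {c} u≢r c≢r same-parent (zs , y≡u++zs) (zs′ , y≡c++zs′) =
    label-injective (proj₁ (∷-injective (++-cancelˡ (key (parent c)) _ _ keys)))
    where
    open ≡-Reasoning
    keys : key (parent c) ++ label u ∷ zs ≡ key (parent c) ++ label c ∷ zs′
    keys = begin
      key (parent c) ++ label u ∷ zs      ≡⟨ cong (λ p → key p ++ label u ∷ zs) same-parent ⟨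
      key (parent u) ++ [ label u ] ++ zs ≡⟨ ++-assoc (key (parent u)) [ label u ] zs ⟨
      (key (parent u) ++ [ label u ]) ++ zs ≡⟨ cong (_++ zs) (key-parent u≢r) ⟨
      key u ++ zs                          ≡⟨ trans (sym y≡u++zs) y≡c++zs′ ⟩
      key c ++ zs′                         ≡⟨ cong (_++ zs′) (key-parent c≢r) ⟩
      (key (parent c) ++ [ label c ]) ++ zs′ ≡⟨ ++-assoc (key (parent c)) [ label c ] zs′ ⟩
      key (parent c) ++ label c ∷ zs′     ∎

  -- The deepest non-leaf vertex below p is an almost-leaf: a non-leaf child of it
  -- would be deeper.
  almost-leaf-below : ∀ {p} → p ≢ r → ¬ IsLeaf G p → ∃[ y ] IsAlmostLeaf G y × y ≢ r × p ≼ y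
  almost-leaf-below {p} p≢r ¬leaf-p =
    y , (¬leaf-y , nonLeafNeighbours≤1 G (parent y) only-parent) , y≢r , p≼y
    where
    NonLeafBelow : Pred (Fin n) 0ℓ
    NonLeafBelow z = ¬ IsLeaf G z × p ≼ z

    nonLeafBelow? : U.Decidable NonLeafBelow
    nonLeafBelow? z = ¬? (isLeaf? G z) ×-dec p ≼? z

    candidates : List (Fin n)
    candidates = filter nonLeafBelow? (allFin n)

    y : Fin n
    y = argmax depth p candidates

    y-spec : NonLeafBelow y
    y-spec = argmax-all depth (¬leaf-p , ≼-refl {p}) (all-filter nonLeafBelow? (allFin n))

    ¬leaf-y : ¬ IsLeaf G y
    ¬leaf-y = proj₁ y-spec

    p≼y : p ≼ y
    p≼y = proj₂ y-spec

    y≢r : y ≢ r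
    y≢r y≡r = p≢r (≼-root {p} (subst (p ≼_) y≡r p≼y))

    only-parent : ∀ {z} → E y z → ¬ IsLeaf G z → z ≡ parent y
    only-parent {z} yz ¬leaf-z with edge⇒ParentEdge yz
    ... | inj₁ (_ , parent-y≡z) = sym parent-y≡z
    ... | inj₂ (z≢r , parent-z≡y) = ⊥-elim (<⇒≱ y<z (lookup (f[xs]≤f[argmax] p candidates) z∈))
      where
      y<z : depth y < depth z
      y<z = subst (λ x → depth x < depth z) parent-z≡y (depth-parent z≢r)
      z∈ : z ∈ candidates
      z∈ = ∈-filter⁺ nonLeafBelow? (∈-allFin z)
             (¬leaf-z , ≼-child {p} {z} (subst (p ≼_) (sym parent-z≡y) p≼y) z≢r)

  module Thinness (r-almost-leaf : IsAlmostLeaf G r)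
                  {y₀} (y₀-almost-leaf : IsAlmostLeaf G y₀) (y₀≢r : y₀ ≢ r) where

    anchor-by : ∀ v → Dec (IsLeaf G v) → Fin n
    anchor-by v (yes _) = parent v
    anchor-by v (no _)  = v

    anchor : Fin n → Fin n
    anchor v = anchor-by v (isLeaf? G v)

    anchor-non-leaf : ∀ {v} → ¬ IsLeaf G v → anchor v ≡ v
    anchor-non-leaf {v} ¬leaf = unfold (isLeaf? G v)
      where
      unfold : (d : Dec (IsLeaf G v)) → anchor-by v d ≡ v
      unfold (yes leaf) = ⊥-elim (¬leaf leaf)
      unfold (no _)     = refl

    anchor-not-leaf : ∀ v → anchor v ≢ r → ¬ IsLeaf G (anchor v)
    anchor-not-leaf v = unfold (isLeaf? G v)
      where
      unfold : (d : Dec (IsLeaf G v)) → anchor-by v d ≢ r → ¬ IsLeaf G (anchor-by v d)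
      unfold (yes leaf) pv≢r = parent-not-leaf {v} (λ { refl → proj₁ r-almost-leaf leaf }) pv≢r
      unfold (no ¬leaf) _    = ¬leaf

    ≼-anchor : ∀ {c v} → c ⊏ v → c ≼ anchor v
    ≼-anchor {c} {v} c⊏v = unfold (isLeaf? G v)
      where
      unfold : (d : Dec (IsLeaf G v)) → c ≼ anchor-by v d
      unfold (yes _) = ≼-parent {c} {v} c⊏v
      unfold (no _)  = ⊏⇒≼ {c} {v} c⊏v

    AlmostLeafBesidesRoot : Pred (Fin n) 0ℓ
    AlmostLeafBesidesRoot y = IsAlmostLeaf G y × y ≢ r

    representative-spec : ∀ v → ∃[ y ] AlmostLeafBesidesRoot y × (anchor v ≢ r → anchor v ≼ y)
    representative-spec v with toSum (anchor v ≟ r)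
    ... | inj₁ anchor≡r = y₀ , (y₀-almost-leaf , y₀≢r) , λ anchor≢r → ⊥-elim (anchor≢r anchor≡r)
    ... | inj₂ anchor≢r =
      let (y , almost-leaf , y≢r , anchor≼y) = almost-leaf-below anchor≢r (anchor-not-leaf v anchor≢r)
      in y , (almost-leaf , y≢r) , λ _ → anchor≼y

    representative : Fin n → Fin n
    representative v = proj₁ (representative-spec v)

    representative-below : ∀ {v} → anchor v ≢ r → anchor v ≼ representative v
    representative-below {v} = proj₂ (proj₂ (representative-spec v))

    almost-leaves : List (Fin n)
    almost-leaves = filter (isAlmostLeaf? G) (allFin n)

    classes : List (Fin n)
    classes = filter (λ y → ¬? (y ≟ r)) almost-leaves

    representative∈classes : ∀ v → representative v ∈ classes
    representative∈classes v =
      let (almost-leaf , y≢r) = proj₁ (proj₂ (representative-spec v))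
      in ∈-filter⁺ (λ y → ¬? (y ≟ r)) (∈-filter⁺ (isAlmostLeaf? G) (∈-allFin _) almost-leaf) y≢r

    class : Fin n → Fin (length classes)
    class v = index (representative∈classes v)

    same-class⇒same-representative : ∀ {u v} → class u ≡ class v → representative u ≡ representative v
    same-class⇒same-representative {u} {v} eq = begin
      representative u                     ≡⟨ lookup-index (representative∈classes u) ⟩
      List.lookup classes (class u)  ≡⟨ cong (List.lookup classes) eq ⟩
      List.lookup classes (class v)  ≡⟨ lookup-index (representative∈classes v) ⟨
      representative v                     ∎
      where open ≡-Reasoning

    classes<almost-leaves : length classes < length almost-leaves
    classes<almost-leaves = filter-notAll (λ y → ¬? (y ≟ r)) almost-leaves
      (Any.map (λ { refl r≢r → r≢r refl }) (∈-filter⁺ (isAlmostLeaf? G) (∈-allFin r) r-almost-leaf))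

    _≺_ : Rel (Fin n) 0ℓ
    u ≺ v = Lex-< _≡_ _<_ (key v) (key u)

    ≺-isStrictTotalOrder : IsStrictTotalOrder _≡_ _≺_
    ≺-isStrictTotalOrder = isStrictTotalOrder-on-injective
      (Flip.isStrictTotalOrder (Lex.<-isStrictTotalOrder ℕ.<-isStrictTotalOrder)) key
      (λ {x} {y} keys → key-injective {x} {y} (Pointwise-≡⇒≡ keys))

    ≺-trans : ∀ {u v w} → u ≺ v → v ≺ w → u ≺ w
    ≺-trans {u} {v} {w} = IsStrictTotalOrder.trans ≺-isStrictTotalOrder {u} {v} {w}

    ¬parent≺child : ∀ {w} → w ≢ r → ¬ parent w ≺ w
    ¬parent≺child {w} w≢r pw≺w = Lex-<-¬extension<prefix <-asym (key (parent w)) (label w) []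
      (subst (λ ks → Lex-< _≡_ _<_ ks (key (parent w))) (key-parent w≢r) pw≺w)

    -- u is not a leaf since its sibling c, having descendants, is not; so the representative
    -- of u lies below u, and that of v below c.
    representatives-differ : ∀ {u c v} → u ≢ r → c ≢ r → parent c ≡ parent u → label c < label u → c ⊏ v →
                             representative u ≢ representative v
    representatives-differ {u} {c} {v} u≢r c≢r siblings label-c<label-u c⊏v same =
      <-irrefl (cong label (sym u≡c)) label-c<label-u
      where
      ¬leaf-u : ¬ IsLeaf G u
      ¬leaf-u leaf = <-asym (label-leaf leaf)
        (≤-<-trans (label-non-leaf (proper-ancestor-not-leaf {c} {v} c⊏v c≢r)) label-c<label-u)

      u≼representative : u ≼ representative u
      u≼representative = subst (_≼ representative u) (anchor-non-leaf ¬leaf-u)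
        (representative-below (subst (_≢ r) (sym (anchor-non-leaf ¬leaf-u)) u≢r))

      c≼anchor : c ≼ anchor v
      c≼anchor = ≼-anchor {c} {v} c⊏v

      anchor≢r : anchor v ≢ r
      anchor≢r anchor≡r = c≢r (≼-root {c} (subst (c ≼_) anchor≡r c≼anchor))

      c≼representative : c ≼ representative u
      c≼representative = subst (c ≼_) (sym same)
        (≼-trans {c} {anchor v} {representative v} c≼anchor (representative-below {v} anchor≢r))

      u≡c : u ≡ c
      u≡c = siblings-disjoint {u} {c} {representative u} u≢r c≢r (sym siblings)
              u≼representative c≼representative

    thin : ∀ u v w → u ≺ v → v ≺ w → class u ≡ class v → E u w → E v w
    thin u v w u≺v v≺w same-class uw with edge⇒ParentEdge uw
    ... | inj₂ (w≢r , refl) = ⊥-elim (¬parent≺child w≢r (≺-trans {u} {v} {w} u≺v v≺w))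
    ... | inj₁ (u≢r , refl)
      with Lex-<-between-∷ʳ <-asym (key (parent u)) (label u) (key v) v≺w
             (subst (Lex-< _≡_ _<_ (key v)) (key-parent u≢r) u≺v)
    ...   | b , [] , kv , _ =
      let (v≢r , parent-v≡w , _) = key-∷ʳ⇒parent {v} {parent u} b kv
      in subst (E v) parent-v≡w (parent-adjacent v≢r)
    ...   | b , l ∷ ls , kv , b<label-u
      with c , c≢r , siblings , refl , kv′ ← child-towards {v} {parent u} b (l ∷ ls) kv =
      ⊥-elim (representatives-differ {u} {c} {v} u≢r c≢r siblings b<label-u (l , ls , kv′)
                (same-class⇒same-representative same-class))

    isThin : IsKThin G (length classes)
    isThin = _≺_ , ≺-isStrictTotalOrder , class , thin

theorem18 : (T : Graph) → IsTree T → 2 ≤ numAlmostLeaves T →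
    ThinAtMost T (numAlmostLeaves T ∸ 1)
theorem18 T (connected , acyclic) 2≤t
  with r , y₀ , r∈ , y₀∈ , r≢y₀
         ← Unique⇒distinct-members (Unique-filter⁺ (isAlmostLeaf? T) (allFin⁺ (Graph.n T))) 2≤t
  = length classes , <⇒≤pred classes<almost-leaves , isThin
  where
  open Graph T
  almost-leaf : ∀ {y} → y ∈ filter (isAlmostLeaf? T) (allFin n) → IsAlmostLeaf T y
  almost-leaf y∈ = proj₂ (∈-filter⁻ (isAlmostLeaf? T) {xs = allFin n} y∈)
  open RootedTree T connected acyclic r
  open Thinness (almost-leaf r∈) (almost-leaf y₀∈) (λ y₀≡r → r≢y₀ (sym y₀≡r))
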